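{- Let $k\ge0$ be an integer and $a,b\in\mathbb{R}$. Let $A_k(a,b)$ be the $(k+1)\times(k+1)$ matrix whose $(i,j)$ entry is $(a-i+1)^{k-j+1}(b+i-1)^{j-1}$ (with the convention $0^0=1$). Then $$\det A_k(a,b)=(a+b)^{k(k+1)/2}\prod_{h=1}^{k}h!.$$ -}

module Defs where

open import Level using (Level)
open import Data.Nat as ℕ using (ℕ; zero; suc; _!)
open import Data.Fin using (Fin; zero; suc; toℕ; punchIn)
open import Algebra.Bundles using (CommutativeRing)
import Algebra.Definitions.RawSemiring as RS
open import Algebra.Bundles using (Semiring)

module _ {c ℓ : Level} (R : CommutativeRing c ℓ) where
  open CommutativeRing R using (Carrier; _+_; _*_; -_; _-_; 0#; 1#; semiring)
  open RS (Semiring.rawSemiring semiring) using (_^_; _×_)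

  -- x ^ m in R, with x ^ 0 = 1 (so 0^0 = 1)
  pow : Carrier → ℕ → Carrier
  pow x m = x ^ m

  sumFin : (n : ℕ) → (Fin n → Carrier) → Carrier
  sumFin zero    f = 0#
  sumFin (suc n) f = f zero + sumFin n (λ j → f (suc j))

  sign : ℕ → Carrier
  sign zero    = 1#
  sign (suc j) = - sign j

  det : (n : ℕ) → (Fin n → Fin n → Carrier) → Carrier
  det zero    M = 1#
  det (suc n) M =
    sumFin (suc n) (λ j → (sign (toℕ j) * M zero j) * det n (λ r s → M (suc r) (punchIn j s)))

  ι : ℕ → Carrier
  ι m = m × 1#

  -- A_k(a,b), 0-indexed: entry (i,j) with i,j ∈ {0..k} is
  -- (a - i)^(k - j) * (b + i)^j  (i.e. with 1-indexed i,j: (a-i+1)^(k-j+1)(b+i-1)^(j-1)).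
  -- _^_ has x ^ 0 = 1, so the convention 0^0 = 1 holds.
  A : (k : ℕ) → Carrier → Carrier → Fin (suc k) → Fin (suc k) → Carrier
  A k a b i j = ((a - ι (toℕ i)) ^ (k ℕ.∸ toℕ j)) * ((b + ι (toℕ i)) ^ toℕ j)

superfactorial : ℕ → ℕ
superfactorial zero    = 1
superfactorial (suc k) = superfactorial k ℕ.* (suc k) !

triangle : ℕ → ℕ
triangle zero    = 0
triangle (suc k) = triangle k ℕ.+ suc k

-- Put x i = a - i and y i = b + i, so that x i + y i = a + b = s in every row; column j of
-- A_k(a,b) is x^(k-j) y^j. Let G_p (homogeneousPowers) be the matrix with columns x^(p-j) y^j,
-- reading x^0 = 1 for j > p, so that G_k = A_k(a,b) and G_0 is the Vandermonde matrix (b + i)^j.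
-- Adding to each of the columns 0, ..., p of G_(p+1) its right neighbour turns x^(p+1-j) y^j into
-- (x + y) x^(p-j) y^j = s x^(p-j) y^j, hence det G_(p+1) = s^(p+1) det G_p and
-- det A_k(a,b) = s^(k(k+1)/2) det G_0. In the Vandermonde matrix, subtracting b times each column
-- from the next clears the first row and turns row i into i (b + i)^(j-1); expanding and pulling
-- out the row factors gives k! times the Vandermonde determinant at the nodes b + 1, ..., b + k,
-- so it equals the superfactorial.

module Submission where

open import Defs
open import Level using (Level)
open import Data.Nat as ℕ using (ℕ; zero; suc; _∸_; _!; s≤s)
import Data.Nat.Properties as ℕ
open import Data.Fin using (Fin; zero; suc; toℕ; inject₁; punchIn; punchOut; fromℕ; fromℕ<; _≟_)
import Data.Fin.Properties as Fin
open import Data.Vec.Functional using (Vector; updateAt; removeAt)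
open import Data.Vec.Functional.Properties using (updateAt-updates; updateAt-minimal)
open import Data.Product using (∃-syntax; _,_) renaming (_×_ to _∧_)
open import Data.Empty using (⊥-elim)
open import Function using (_∘_; const)
open import Relation.Nullary using (yes; no)
open import Relation.Binary.PropositionalEquality as ≡ using (_≡_; _≢_)
open import Relation.Binary.Bundles using (Setoid)
open import Algebra.Bundles using (CommutativeRing; Semiring)
import Algebra.Definitions.RawSemiring as RawSemiringDefinitions
import Algebra.Properties.Semiring.Sum as SemiringSum
import Algebra.Properties.CommutativeMonoid.Sum as CommutativeMonoidSum
import Algebra.Properties.Ring as RingProperties
import Algebra.Properties.AbelianGroup as AbelianGroupProperties
import Algebra.Properties.Semiring.Exp as SemiringExp
import Algebra.Properties.Semiring.Mult as SemiringMult
import Algebra.Solver.Ring.NaturalCoefficients.Default as NaturalCoefficientsSolver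

punchIn-adjacent : ∀ {n} (j : Fin (suc (suc n))) (p : Fin (suc n)) → j ≢ inject₁ p → j ≢ suc p →
  ∃[ p′ ] punchIn j (inject₁ p′) ≡ inject₁ p ∧ punchIn j (suc p′) ≡ suc p
punchIn-adjacent zero                   zero    j≢p _     = ⊥-elim (j≢p ≡.refl)
punchIn-adjacent zero                   (suc p) _   _     = p , ≡.refl , ≡.refl
punchIn-adjacent (suc zero)             zero    _   j≢p+1 = ⊥-elim (j≢p+1 ≡.refl)
punchIn-adjacent {suc n} (suc (suc j))  zero    _   _     = zero , ≡.refl , ≡.refl
punchIn-adjacent {suc n} (suc j)        (suc p) j≢p j≢p+1
  with punchIn-adjacent j p (j≢p ∘ ≡.cong suc) (j≢p+1 ∘ ≡.cong suc)
... | p′ , e , e′ = suc p′ , ≡.cong suc e , ≡.cong suc e′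

inject₁≢suc : ∀ {n} (p : Fin n) → inject₁ p ≢ suc p
inject₁≢suc zero    ()
inject₁≢suc (suc p) = inject₁≢suc p ∘ Fin.suc-injective

module _ {a ℓ : Level} (S : Setoid a ℓ) where
  open Setoid S

  removeAt-adjacent : ∀ {n} (f : Vector Carrier (suc (suc n))) (p : Fin (suc n)) →
    f (inject₁ p) ≈ f (suc p) → ∀ s → removeAt f (inject₁ p) s ≈ removeAt f (suc p) s
  removeAt-adjacent         f zero    e zero    = sym e
  removeAt-adjacent         f zero    e (suc s) = refl
  removeAt-adjacent         f (suc p) e zero    = refl
  removeAt-adjacent {suc n} f (suc p) e (suc s) = removeAt-adjacent (f ∘ suc) p e s

module _ {c ℓ : Level} (R : CommutativeRing c ℓ) where

  open CommutativeRing R hiding (zero)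
  open RawSemiringDefinitions (Semiring.rawSemiring semiring) using (_^_)
  open SemiringSum semiring using (sum; sum-cong-≋; sum-replicate-zero; ∑-distrib-+; *-distribˡ-sum)
  open CommutativeMonoidSum *-commutativeMonoid using ()
    renaming (sum to ∏; sum-cong-≋ to ∏-cong; sum-remove to ∏-remove; sum-init-last to ∏-init-last;
              sum-replicate-zero to ∏-replicate-one)
  open RingProperties ring using (-‿distribˡ-*)
  open AbelianGroupProperties +-abelianGroup using (xyx⁻¹≈y)
  open SemiringExp semiring using (^-homo-*; ^-congˡ)
  open SemiringMult semiring using (×1-homo-*)
  open NaturalCoefficientsSolver commutativeSemiring using (solve; _:=_; _:+_; _:*_; con)
  open import Relation.Binary.Reasoning.Setoid setoid

  -- Laplace expansion along the first row

  Matrix : ℕ → Set c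
  Matrix n = Fin n → Fin n → Carrier

  minor : ∀ {n} → Fin (suc n) → Matrix (suc n) → Matrix n
  minor j M i = removeAt (M (suc i)) j

  setCol : ∀ {n} → Matrix n → Fin n → Vector Carrier n → Matrix n
  setCol M q v i = updateAt (M i) q (const (v i))

  laplaceTerm : ∀ {n} → Matrix (suc n) → Fin (suc n) → Carrier
  laplaceTerm {n} M j = (sign R (toℕ j) * M zero j) * det R n (minor j M)

  sumFin≡sum : ∀ n (f : Vector Carrier n) → sumFin R n f ≡ sum f
  sumFin≡sum zero    f = ≡.refl
  sumFin≡sum (suc n) f = ≡.cong (f zero +_) (sumFin≡sum n (f ∘ suc))

  det-expand : ∀ {n} (M : Matrix (suc n)) → det R (suc n) M ≡ sum (laplaceTerm M)
  det-expand M = sumFin≡sum _ (laplaceTerm M)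

  det-cong : ∀ n {M N : Matrix n} → (∀ i j → M i j ≈ N i j) → det R n M ≈ det R n N
  det-cong zero    M≈N = refl
  det-cong (suc n) {M} {N} M≈N = begin
    det R (suc n) M       ≡⟨ det-expand M ⟩
    sum (laplaceTerm M)   ≈⟨ sum-cong-≋ (λ j → *-cong (*-congˡ {sign R (toℕ j)} (M≈N zero j))
                                                    (det-cong n (λ i s → M≈N (suc i) (punchIn j s)))) ⟩
    sum (laplaceTerm N)   ≡⟨ det-expand N ⟨
    det R (suc n) N       ∎

  det-scaleRows : ∀ n (u : Vector Carrier n) (M : Matrix n) →
                  det R n (λ i j → u i * M i j) ≈ ∏ u * det R n M
  det-scaleRows zero    u M = sym (*-identityʳ 1#)
  det-scaleRows (suc n) u M = begin
    det R (suc n) uM                        ≡⟨ det-expand uM ⟩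
    sum (laplaceTerm uM)                    ≈⟨ sum-cong-≋ term ⟩
    sum (λ j → ∏ u * laplaceTerm M j)       ≈⟨ *-distribˡ-sum (∏ u) (laplaceTerm M) ⟨
    ∏ u * sum (laplaceTerm M)               ≡⟨ ≡.cong (∏ u *_) (det-expand M) ⟨
    ∏ u * det R (suc n) M                   ∎
    where
    uM : Matrix (suc n)
    uM i j = u i * M i j
    term : ∀ j → laplaceTerm uM j ≈ ∏ u * laplaceTerm M j
    term j = begin
      (sign R (toℕ j) * (u zero * M zero j)) * det R n (minor j uM)
        ≈⟨ *-congˡ (det-scaleRows n (u ∘ suc) (minor j M)) ⟩
      (sign R (toℕ j) * (u zero * M zero j)) * (∏ (u ∘ suc) * det R n (minor j M))
        ≈⟨ solve 5 (λ σ u₀ m p d → (σ :* (u₀ :* m)) :* (p :* d) := (u₀ :* p) :* ((σ :* m) :* d)) refl _ _ _ _ _ ⟩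
      ∏ u * laplaceTerm M j ∎

  det-scaleCols : ∀ n (u : Vector Carrier n) (M : Matrix n) →
                  det R n (λ i j → M i j * u j) ≈ ∏ u * det R n M
  det-scaleCols zero    u M = sym (*-identityʳ 1#)
  det-scaleCols (suc n) u M = begin
    det R (suc n) Mu                        ≡⟨ det-expand Mu ⟩
    sum (laplaceTerm Mu)                    ≈⟨ sum-cong-≋ term ⟩
    sum (λ j → ∏ u * laplaceTerm M j)       ≈⟨ *-distribˡ-sum (∏ u) (laplaceTerm M) ⟨
    ∏ u * sum (laplaceTerm M)               ≡⟨ ≡.cong (∏ u *_) (det-expand M) ⟨
    ∏ u * det R (suc n) M                   ∎
    where
    Mu : Matrix (suc n)
    Mu i j = M i j * u j
    term : ∀ j → laplaceTerm Mu j ≈ ∏ u * laplaceTerm M j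
    term j = begin
      (sign R (toℕ j) * (M zero j * u j)) * det R n (minor j Mu)
        ≈⟨ *-congˡ (det-scaleCols n (removeAt u j) (minor j M)) ⟩
      (sign R (toℕ j) * (M zero j * u j)) * (∏ (removeAt u j) * det R n (minor j M))
        ≈⟨ solve 5 (λ σ m uⱼ p d → (σ :* (m :* uⱼ)) :* (p :* d) := (uⱼ :* p) :* ((σ :* m) :* d)) refl _ _ _ _ _ ⟩
      (u j * ∏ (removeAt u j)) * laplaceTerm M j
        ≈⟨ *-congʳ (∏-remove u) ⟨
      ∏ u * laplaceTerm M j ∎

  -- Multilinearity and alternation in the columns

  minor-setCol-same : ∀ {n} (M : Matrix (suc n)) (q : Fin (suc n)) v i s →
                      minor q (setCol M q v) i s ≡ minor q M i s
  minor-setCol-same M q v i s = updateAt-minimal (punchIn q s) q (M (suc i)) (Fin.punchInᵢ≢i q s)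

  minor-setCol : ∀ {n} (M : Matrix (suc n)) {j q : Fin (suc n)} (j≢q : j ≢ q) v i s →
                 minor j (setCol M q v) i s ≡ setCol (minor j M) (punchOut j≢q) (v ∘ suc) i s
  minor-setCol M {j} {q} j≢q v i s with s ≟ punchOut j≢q
  ... | yes ≡.refl = ≡.trans (≡.cong (updateAt (M (suc i)) q _) (Fin.punchIn-punchOut j≢q))
                     (≡.trans (updateAt-updates q (M (suc i)))
                              (≡.sym (updateAt-updates (punchOut j≢q) (minor j M i))))
  ... | no s≢ = ≡.trans (updateAt-minimal (punchIn j s) q (M (suc i)) punchIn≢q)
                        (≡.sym (updateAt-minimal s (punchOut j≢q) (minor j M i) s≢))
    where
    punchIn≢q : punchIn j s ≢ q
    punchIn≢q e = s≢ (Fin.punchIn-injective j s (punchOut j≢q) (≡.trans e (≡.sym (Fin.punchIn-punchOut j≢q))))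

  laplaceTerm-setCol-same : ∀ {n} (M : Matrix (suc n)) q v →
    laplaceTerm (setCol M q v) q ≈ (sign R (toℕ q) * v zero) * det R n (minor q M)
  laplaceTerm-setCol-same {n} M q v =
    *-cong (*-congˡ (reflexive (updateAt-updates q (M zero))))
           (det-cong n (λ i s → reflexive (minor-setCol-same M q v i s)))

  laplaceTerm-setCol-other : ∀ {n} (M : Matrix (suc n)) {j q} (j≢q : j ≢ q) v →
    laplaceTerm (setCol M q v) j ≈ (sign R (toℕ j) * M zero j) * det R n (setCol (minor j M) (punchOut j≢q) (v ∘ suc))
  laplaceTerm-setCol-other {n} M {j} {q} j≢q v =
    *-cong (*-congˡ (reflexive (updateAt-minimal j q (M zero) j≢q)))
           (det-cong n (λ i s → reflexive (minor-setCol M j≢q v i s)))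

  det-linearCol : ∀ n (M : Matrix n) (q : Fin n) (u w : Vector Carrier n) (t : Carrier) →
    det R n (setCol M q (λ i → u i + t * w i)) ≈ det R n (setCol M q u) + t * det R n (setCol M q w)
  det-linearCol (suc n) M q u w t = begin
    det R (suc n) Mv                                        ≡⟨ det-expand Mv ⟩
    sum (laplaceTerm Mv)                                    ≈⟨ sum-cong-≋ term ⟩
    sum (λ j → laplaceTerm Mu j + t * laplaceTerm Mw j)     ≈⟨ ∑-distrib-+ (laplaceTerm Mu) (λ j → t * laplaceTerm Mw j) ⟩
    sum (laplaceTerm Mu) + sum (λ j → t * laplaceTerm Mw j) ≈⟨ +-congˡ (*-distribˡ-sum t (laplaceTerm Mw)) ⟨
    sum (laplaceTerm Mu) + t * sum (laplaceTerm Mw)         ≡⟨ ≡.cong₂ (λ x y → x + t * y) (det-expand Mu) (det-expand Mw) ⟨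
    det R (suc n) Mu + t * det R (suc n) Mw                 ∎
    where
    v : Vector Carrier (suc n)
    v i = u i + t * w i
    Mv Mu Mw : Matrix (suc n)
    Mv = setCol M q v
    Mu = setCol M q u
    Mw = setCol M q w
    expand : ∀ σ x y d → (σ * (x + t * y)) * d ≈ (σ * x) * d + t * ((σ * y) * d)
    expand = solve 5 (λ t σ x y d → (σ :* (x :+ t :* y)) :* d := (σ :* x) :* d :+ t :* ((σ :* y) :* d)) refl t
    term : ∀ j → laplaceTerm Mv j ≈ laplaceTerm Mu j + t * laplaceTerm Mw j
    term j with j ≟ q
    ... | yes ≡.refl = begin
      laplaceTerm Mv j                                                  ≈⟨ laplaceTerm-setCol-same M j v ⟩
      (σ * (u zero + t * w zero)) * det R n (minor j M)                 ≈⟨ expand σ _ _ _ ⟩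
      (σ * u zero) * det R n (minor j M) + t * ((σ * w zero) * det R n (minor j M))
        ≈⟨ +-cong (laplaceTerm-setCol-same M j u) (*-congˡ (laplaceTerm-setCol-same M j w)) ⟨
      laplaceTerm Mu j + t * laplaceTerm Mw j                           ∎
      where σ = sign R (toℕ j)
    ... | no j≢q = begin
      laplaceTerm Mv j                                 ≈⟨ laplaceTerm-setCol-other M j≢q v ⟩
      a * det R n (setCol N q′ (λ i → u (suc i) + t * w (suc i)))
        ≈⟨ *-congˡ (det-linearCol n N q′ (u ∘ suc) (w ∘ suc) t) ⟩
      a * (det R n (setCol N q′ (u ∘ suc)) + t * det R n (setCol N q′ (w ∘ suc)))
        ≈⟨ solve 4 (λ t a d e → a :* (d :+ t :* e) := a :* d :+ t :* (a :* e)) refl t a _ _ ⟩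
      a * det R n (setCol N q′ (u ∘ suc)) + t * (a * det R n (setCol N q′ (w ∘ suc)))
        ≈⟨ +-cong (laplaceTerm-setCol-other M j≢q u) (*-congˡ (laplaceTerm-setCol-other M j≢q w)) ⟨
      laplaceTerm Mu j + t * laplaceTerm Mw j          ∎
      where
      a = sign R (toℕ j) * M zero j
      N = minor j M
      q′ = punchOut j≢q

  sum-zero : ∀ {n} (t : Vector Carrier n) → (∀ j → t j ≈ 0#) → sum t ≈ 0#
  sum-zero {n} t t≈0 = trans (sum-cong-≋ t≈0) (sum-replicate-zero n)

  sum-adjacentPair : ∀ {n} (t : Vector Carrier (suc (suc n))) (p : Fin (suc n)) →
    (∀ j → j ≢ inject₁ p → j ≢ suc p → t j ≈ 0#) → sum t ≈ t (inject₁ p) + t (suc p)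
  sum-adjacentPair t zero others =
    +-congˡ (trans (+-congˡ (sum-zero _ (λ j → others (suc (suc j)) (λ ()) (λ ())))) (+-identityʳ _))
  sum-adjacentPair {suc n} t (suc p) others =
    trans (+-cong (others zero (λ ()) (λ ()))
                  (sum-adjacentPair (t ∘ suc) p (λ j j≢p j≢p+1 → others (suc j) (j≢p ∘ Fin.suc-injective)
                                                                            (j≢p+1 ∘ Fin.suc-injective))))
          (+-identityˡ _)

  det-equalAdjacentCols : ∀ n (M : Matrix (suc n)) (p : Fin n) →
    (∀ i → M i (inject₁ p) ≈ M i (suc p)) → det R (suc n) M ≈ 0#
  det-equalAdjacentCols (suc n) M p cols≈ = begin
    det R (suc (suc n)) M                              ≡⟨ det-expand M ⟩
    sum (laplaceTerm M)                                ≈⟨ sum-adjacentPair (laplaceTerm M) p others ⟩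
    laplaceTerm M (inject₁ p) + laplaceTerm M (suc p)  ≈⟨ +-cong left right ⟩
    (σ * m) * d + (- σ * m) * d                        ≈⟨ +-congˡ (trans (*-congʳ (sym (-‿distribˡ-* σ m)))
                                                                        (sym (-‿distribˡ-* (σ * m) d))) ⟩
    (σ * m) * d + - ((σ * m) * d)                      ≈⟨ -‿inverseʳ _ ⟩
    0#                                                 ∎
    where
    σ = sign R (toℕ p)
    m = M zero (inject₁ p)
    d = det R (suc n) (minor (inject₁ p) M)
    left : laplaceTerm M (inject₁ p) ≈ (σ * m) * d
    left = *-congʳ (*-congʳ (reflexive (≡.cong (sign R) (Fin.toℕ-inject₁ p))))
    right : laplaceTerm M (suc p) ≈ (- σ * m) * d
    right = *-cong (*-congˡ (sym (cols≈ zero)))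
                   (det-cong (suc n) (λ i s → sym (removeAt-adjacent setoid (M (suc i)) p (cols≈ (suc i)) s)))
    others : ∀ j → j ≢ inject₁ p → j ≢ suc p → laplaceTerm M j ≈ 0#
    others j j≢p j≢p+1 with punchIn-adjacent j p j≢p j≢p+1
    ... | p′ , e , e′ = trans (*-congˡ (det-equalAdjacentCols n (minor j M) p′ cols′≈)) (zeroʳ _)
      where
      cols′≈ : ∀ i → minor j M i (inject₁ p′) ≈ minor j M i (suc p′)
      cols′≈ i = trans (reflexive (≡.cong (M (suc i)) e))
                       (trans (cols≈ (suc i)) (reflexive (≡.cong (M (suc i)) (≡.sym e′))))

  setCol-self : ∀ {n} (M : Matrix n) q i j → setCol M q (λ i → M i q) i j ≡ M i j
  setCol-self M q i j with j ≟ q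
  ... | yes ≡.refl = updateAt-updates q (M i)
  ... | no j≢q     = updateAt-minimal j q (M i) j≢q

  det-addCol : ∀ n (M : Matrix n) q r t →
    det R n (setCol M q (λ i → M i q + t * M i r)) ≈ det R n M + t * det R n (setCol M q (λ i → M i r))
  det-addCol n M q r t =
    trans (det-linearCol n M q (λ i → M i q) (λ i → M i r) t)
          (+-congʳ (det-cong n (λ i j → reflexive (setCol-self M q i j))))

  y≈0⇒x+t*y≈x : ∀ x t {y} → y ≈ 0# → x + t * y ≈ x
  y≈0⇒x+t*y≈x x t y≈0 = trans (+-congˡ (trans (*-congˡ y≈0) (zeroʳ t))) (+-identityʳ x)

  det-addRightNeighbour : ∀ n (M : Matrix (suc n)) (p : Fin n) t →
    det R (suc n) (setCol M (inject₁ p) (λ i → M i (inject₁ p) + t * M i (suc p))) ≈ det R (suc n) M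
  det-addRightNeighbour n M p t =
    trans (det-addCol (suc n) M (inject₁ p) (suc p) t) (y≈0⇒x+t*y≈x _ t (det-equalAdjacentCols n D p duplicate))
    where
    D = setCol M (inject₁ p) (λ i → M i (suc p))
    duplicate : ∀ i → D i (inject₁ p) ≈ D i (suc p)
    duplicate i = reflexive (≡.trans (updateAt-updates (inject₁ p) (M i))
                                     (≡.sym (updateAt-minimal (suc p) (inject₁ p) (M i) (inject₁≢suc p ∘ ≡.sym))))

  det-addLeftNeighbour : ∀ n (M : Matrix (suc n)) (p : Fin n) t →
    det R (suc n) (setCol M (suc p) (λ i → M i (suc p) + t * M i (inject₁ p))) ≈ det R (suc n) M
  det-addLeftNeighbour n M p t =
    trans (det-addCol (suc n) M (suc p) (inject₁ p) t) (y≈0⇒x+t*y≈x _ t (det-equalAdjacentCols n D p duplicate))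
    where
    D = setCol M (suc p) (λ i → M i (inject₁ p))
    duplicate : ∀ i → D i (inject₁ p) ≈ D i (suc p)
    duplicate i = reflexive (≡.trans (updateAt-minimal (inject₁ p) (suc p) (M i) (inject₁≢suc p))
                                     (≡.sym (updateAt-updates (suc p) (M i))))

  det-expandCorner : ∀ n (M : Matrix (suc n)) → (∀ j → M zero (suc j) ≈ 0#) →
    det R (suc n) M ≈ M zero zero * det R n (λ i j → M (suc i) (suc j))
  det-expandCorner n M row≈0 = begin
    det R (suc n) M                                     ≡⟨ det-expand M ⟩
    laplaceTerm M zero + sum (laplaceTerm M ∘ suc)      ≈⟨ +-cong (*-congʳ (*-identityˡ _)) (sum-zero _ others) ⟩
    M zero zero * det R n (minor zero M) + 0#           ≈⟨ +-identityʳ _ ⟩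
    M zero zero * det R n (λ i j → M (suc i) (suc j))   ∎
    where
    others : ∀ j → laplaceTerm M (suc j) ≈ 0#
    others j = trans (*-congʳ (trans (*-congˡ (row≈0 j)) (zeroʳ _))) (zeroˡ _)

  -- Sweeps of adjacent column operations

  fromRows : ∀ {n} → (Fin n → ℕ → Carrier) → Matrix n
  fromRows f i j = f i (toℕ j)

  sweepRight : Carrier → ℕ → (ℕ → Carrier) → ℕ → Carrier
  sweepRight t zero    f c       = f c
  sweepRight t (suc L) f zero    = f 0 + t * f 1
  sweepRight t (suc L) f (suc c) = sweepRight t L (f ∘ suc) c

  sweepRight-< : ∀ t f {L c} → c ℕ.< L → sweepRight t L f c ≡ f c + t * f (suc c)
  sweepRight-< t f {suc L} {zero}  _         = ≡.refl
  sweepRight-< t f {suc L} {suc c} (s≤s c<L) = sweepRight-< t (f ∘ suc) c<L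

  sweepRight-≥ : ∀ t f {L c} → L ℕ.≤ c → sweepRight t L f c ≡ f c
  sweepRight-≥ t f {zero}          _         = ≡.refl
  sweepRight-≥ t f {suc L} {suc c} (s≤s L≤c) = sweepRight-≥ t (f ∘ suc) L≤c

  sweepRight-≢ : ∀ t f {L c} → c ≢ L → sweepRight t (suc L) f c ≡ sweepRight t L f c
  sweepRight-≢ t f {zero}  {zero}  c≢L = ⊥-elim (c≢L ≡.refl)
  sweepRight-≢ t f {suc L} {zero}  _   = ≡.refl
  sweepRight-≢ t f {zero}  {suc c} _   = ≡.refl
  sweepRight-≢ t f {suc L} {suc c} c≢L = sweepRight-≢ t (f ∘ suc) (c≢L ∘ ≡.cong suc)

  sweepRight-at : ∀ t f L → sweepRight t (suc L) f L ≡ sweepRight t L f L + t * sweepRight t L f (suc L)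
  sweepRight-at t f zero    = ≡.refl
  sweepRight-at t f (suc L) = sweepRight-at t (f ∘ suc) L

  det-sweepRight-step : ∀ {n} (f : Fin (suc n) → ℕ → Carrier) t (p : Fin n) →
    det R (suc n) (fromRows (λ i → sweepRight t (suc (toℕ p)) (f i))) ≈
    det R (suc n) (fromRows (λ i → sweepRight t (toℕ p) (f i)))
  det-sweepRight-step {n} f t p = trans (det-cong (suc n) entries) (det-addRightNeighbour n M p t)
    where
    M : Matrix (suc n)
    M = fromRows (λ i → sweepRight t (toℕ p) (f i))
    entries : ∀ i j → sweepRight t (suc (toℕ p)) (f i) (toℕ j) ≈
                      setCol M (inject₁ p) (λ i → M i (inject₁ p) + t * M i (suc p)) i j
    entries i j with j ≟ inject₁ p
    ... | yes ≡.refl = begin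
      sweepRight t (suc (toℕ p)) (f i) (toℕ (inject₁ p))  ≡⟨ ≡.cong (sweepRight t (suc (toℕ p)) (f i)) (Fin.toℕ-inject₁ p) ⟩
      sweepRight t (suc (toℕ p)) (f i) (toℕ p)            ≡⟨ sweepRight-at t (f i) (toℕ p) ⟩
      sweepRight t (toℕ p) (f i) (toℕ p) + t * M i (suc p) ≡⟨ ≡.cong (λ c → sweepRight t (toℕ p) (f i) c + t * M i (suc p)) (Fin.toℕ-inject₁ p) ⟨
      M i (inject₁ p) + t * M i (suc p)                    ≡⟨ updateAt-updates (inject₁ p) (M i) ⟨
      setCol M (inject₁ p) (λ i → M i (inject₁ p) + t * M i (suc p)) i (inject₁ p) ∎
    ... | no j≢p = reflexive (≡.trans (sweepRight-≢ t (f i) (λ e → j≢p (Fin.toℕ-injective (≡.trans e (≡.sym (Fin.toℕ-inject₁ p))))))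
                                      (≡.sym (updateAt-minimal j (inject₁ p) (M i) j≢p)))

  det-sweepRight : ∀ {n} (f : Fin (suc n) → ℕ → Carrier) t L → L ℕ.≤ n →
    det R (suc n) (fromRows (λ i → sweepRight t L (f i))) ≈ det R (suc n) (fromRows f)
  det-sweepRight f t zero    _   = refl
  det-sweepRight f t (suc L) L<n = trans step (det-sweepRight f t L (ℕ.<⇒≤ L<n))
    where
    S : ℕ → Matrix _
    S L = fromRows (λ i → sweepRight t L (f i))
    step : det R _ (S (suc L)) ≈ det R _ (S L)
    step = ≡.subst (λ L → det R _ (S (suc L)) ≈ det R _ (S L)) (Fin.toℕ-fromℕ< L<n)
                   (det-sweepRight-step f t (fromℕ< L<n))

  sweepLeft : Carrier → ℕ → (ℕ → Carrier) → ℕ → Carrier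
  sweepLeft t zero    f zero    = f 0
  sweepLeft t zero    f (suc c) = f (suc c) + t * f c
  sweepLeft t (suc m) f zero    = f 0
  sweepLeft t (suc m) f (suc c) = sweepLeft t m (f ∘ suc) c

  sweepLeft-≤ : ∀ t f {m c} → c ℕ.≤ m → sweepLeft t m f c ≡ f c
  sweepLeft-≤ t f {zero}  {zero}  _         = ≡.refl
  sweepLeft-≤ t f {suc m} {zero}  _         = ≡.refl
  sweepLeft-≤ t f {suc m} {suc c} (s≤s c≤m) = sweepLeft-≤ t (f ∘ suc) c≤m

  sweepLeft-≢ : ∀ t f {m c} → c ≢ suc m → sweepLeft t m f c ≡ sweepLeft t (suc m) f c
  sweepLeft-≢ t f {zero}  {zero}        _     = ≡.refl
  sweepLeft-≢ t f {suc m} {zero}        _     = ≡.refl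
  sweepLeft-≢ t f {zero}  {suc zero}    c≢m+1 = ⊥-elim (c≢m+1 ≡.refl)
  sweepLeft-≢ t f {zero}  {suc (suc c)} _     = ≡.refl
  sweepLeft-≢ t f {suc m} {suc c}       c≢m+1 = sweepLeft-≢ t (f ∘ suc) (c≢m+1 ∘ ≡.cong suc)

  sweepLeft-at : ∀ t f m → sweepLeft t m f (suc m) ≡ sweepLeft t (suc m) f (suc m) + t * sweepLeft t (suc m) f m
  sweepLeft-at t f zero    = ≡.refl
  sweepLeft-at t f (suc m) = sweepLeft-at t (f ∘ suc) m

  det-sweepLeft-step : ∀ {n} (f : Fin (suc n) → ℕ → Carrier) t (p : Fin n) →
    det R (suc n) (fromRows (λ i → sweepLeft t (toℕ p) (f i))) ≈
    det R (suc n) (fromRows (λ i → sweepLeft t (suc (toℕ p)) (f i)))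
  det-sweepLeft-step {n} f t p = trans (det-cong (suc n) entries) (det-addLeftNeighbour n M p t)
    where
    M : Matrix (suc n)
    M = fromRows (λ i → sweepLeft t (suc (toℕ p)) (f i))
    entries : ∀ i j → sweepLeft t (toℕ p) (f i) (toℕ j) ≈
                      setCol M (suc p) (λ i → M i (suc p) + t * M i (inject₁ p)) i j
    entries i j with j ≟ suc p
    ... | yes ≡.refl = begin
      sweepLeft t (toℕ p) (f i) (suc (toℕ p))                    ≡⟨ sweepLeft-at t (f i) (toℕ p) ⟩
      M i (suc p) + t * sweepLeft t (suc (toℕ p)) (f i) (toℕ p)  ≡⟨ ≡.cong (λ c → M i (suc p) + t * sweepLeft t (suc (toℕ p)) (f i) c) (Fin.toℕ-inject₁ p) ⟨
      M i (suc p) + t * M i (inject₁ p)                          ≡⟨ updateAt-updates (suc p) (M i) ⟨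
      setCol M (suc p) (λ i → M i (suc p) + t * M i (inject₁ p)) i (suc p) ∎
    ... | no j≢p+1 = reflexive (≡.trans (sweepLeft-≢ t (f i) (j≢p+1 ∘ Fin.toℕ-injective))
                                        (≡.sym (updateAt-minimal j (suc p) (M i) j≢p+1)))

  det-sweepLeft : ∀ {n} (f : Fin (suc n) → ℕ → Carrier) t →
    det R (suc n) (fromRows (λ i → sweepLeft t 0 (f i))) ≈ det R (suc n) (fromRows f)
  det-sweepLeft {n} f t = trans (sweep n ℕ.≤-refl) (det-cong (suc n) untouched)
    where
    S : ℕ → Matrix (suc n)
    S m = fromRows (λ i → sweepLeft t m (f i))
    sweep : ∀ m → m ℕ.≤ n → det R (suc n) (S 0) ≈ det R (suc n) (S m)
    sweep zero    _   = refl
    sweep (suc m) m<n = trans (sweep m (ℕ.<⇒≤ m<n))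
      (≡.subst (λ m → det R (suc n) (S m) ≈ det R (suc n) (S (suc m))) (Fin.toℕ-fromℕ< m<n)
               (det-sweepLeft-step f t (fromℕ< m<n)))
    untouched : ∀ i j → S n i j ≈ fromRows f i j
    untouched i j = reflexive (sweepLeft-≤ t (f i) (ℕ.≤-pred (Fin.toℕ<n j)))

  -- Homogeneous power and Vandermonde determinants

  prefixFactor : ℕ → Carrier → ℕ → Carrier
  prefixFactor zero    s c       = 1#
  prefixFactor (suc m) s zero    = s
  prefixFactor (suc m) s (suc c) = prefixFactor m s c

  prefixFactor-< : ∀ s {m c} → c ℕ.< m → prefixFactor m s c ≡ s
  prefixFactor-< s {suc m} {zero}  _         = ≡.refl
  prefixFactor-< s {suc m} {suc c} (s≤s c<m) = prefixFactor-< s c<m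

  prefixFactor-≥ : ∀ s {m c} → m ℕ.≤ c → prefixFactor m s c ≡ 1#
  prefixFactor-≥ s {zero}          _         = ≡.refl
  prefixFactor-≥ s {suc m} {suc c} (s≤s m≤c) = prefixFactor-≥ s m≤c

  ∏-prefixFactor : ∀ {n} m s → m ℕ.≤ n → ∏ (λ (j : Fin n) → prefixFactor m s (toℕ j)) ≈ s ^ m
  ∏-prefixFactor {n}     zero    s _         = ∏-replicate-one n
  ∏-prefixFactor {suc n} (suc m) s (s≤s m≤n) = *-congˡ (∏-prefixFactor m s m≤n)

  x-u+[y+u]≈x+y : ∀ x y u → (x - u) + (y + u) ≈ x + y
  x-u+[y+u]≈x+y x y u = begin
    (x + - u) + (y + u)  ≈⟨ solve 4 (λ x y u v → (x :+ v) :+ (y :+ u) := (x :+ y) :+ (u :+ v)) refl x y u (- u) ⟩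
    (x + y) + (u + - u)  ≈⟨ +-congˡ (-‿inverseʳ u) ⟩
    (x + y) + 0#         ≈⟨ +-identityʳ _ ⟩
    x + y                ∎

  module _ {n : ℕ} (x y : Vector Carrier (suc n)) where

    homogeneousPowers : ℕ → Matrix (suc n)
    homogeneousPowers p = fromRows (λ i c → x i ^ (p ∸ c) * y i ^ c)

    module _ (s : Carrier) (x+y≈s : ∀ i → x i + y i ≈ s) where

      sweepRight-homogeneousPowers : ∀ p i c →
        sweepRight 1# (suc p) (λ c → x i ^ (suc p ∸ c) * y i ^ c) c ≈ (x i ^ (p ∸ c) * y i ^ c) * prefixFactor (suc p) s c
      sweepRight-homogeneousPowers p i c with c ℕ.<? suc p
      ... | yes c<p+1 = begin
        sweepRight 1# (suc p) _ c                               ≡⟨ sweepRight-< 1# _ c<p+1 ⟩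
        x i ^ (suc p ∸ c) * y i ^ c + 1# * (X * (y i * Y))      ≡⟨ ≡.cong (λ e → x i ^ e * y i ^ c + 1# * (X * (y i * Y)))
                                                                          (ℕ.+-∸-assoc 1 (ℕ.≤-pred c<p+1)) ⟩
        (x i * X) * Y + 1# * (X * (y i * Y))
          ≈⟨ solve 4 (λ x y X Y → (x :* X) :* Y :+ con 1 :* (X :* (y :* Y)) := (X :* Y) :* (x :+ y)) refl (x i) (y i) X Y ⟩
        (X * Y) * (x i + y i)                                  ≈⟨ *-congˡ (x+y≈s i) ⟩
        (X * Y) * s                                            ≡⟨ ≡.cong ((X * Y) *_) (prefixFactor-< s c<p+1) ⟨
        (X * Y) * prefixFactor (suc p) s c                     ∎
        where
        X = x i ^ (p ∸ c)
        Y = y i ^ c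
      ... | no c≮p+1 = begin
        sweepRight 1# (suc p) _ c                              ≡⟨ sweepRight-≥ 1# _ p+1≤c ⟩
        x i ^ (suc p ∸ c) * y i ^ c                            ≡⟨ ≡.cong (λ e → x i ^ e * y i ^ c) (ℕ.m≤n⇒m∸n≡0 p+1≤c) ⟩
        1# * y i ^ c                                           ≡⟨ ≡.cong (λ e → x i ^ e * y i ^ c) (ℕ.m≤n⇒m∸n≡0 (ℕ.<⇒≤ p+1≤c)) ⟨
        x i ^ (p ∸ c) * y i ^ c                                ≈⟨ *-identityʳ _ ⟨
        (x i ^ (p ∸ c) * y i ^ c) * 1#                         ≡⟨ ≡.cong ((x i ^ (p ∸ c) * y i ^ c) *_) (prefixFactor-≥ s p+1≤c) ⟨
        (x i ^ (p ∸ c) * y i ^ c) * prefixFactor (suc p) s c   ∎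
        where
        p+1≤c = ℕ.≮⇒≥ c≮p+1

      det-homogeneousPowers-suc : ∀ p → p ℕ.< n →
        det R (suc n) (homogeneousPowers (suc p)) ≈ s ^ suc p * det R (suc n) (homogeneousPowers p)
      det-homogeneousPowers-suc p p<n = begin
        det R (suc n) (homogeneousPowers (suc p))
          ≈⟨ det-sweepRight (λ i c → x i ^ (suc p ∸ c) * y i ^ c) 1# (suc p) p<n ⟨
        det R (suc n) (fromRows (λ i → sweepRight 1# (suc p) (λ c → x i ^ (suc p ∸ c) * y i ^ c)))
          ≈⟨ det-cong (suc n) (λ i j → sweepRight-homogeneousPowers p i (toℕ j)) ⟩
        det R (suc n) (λ i j → homogeneousPowers p i j * prefixFactor (suc p) s (toℕ j))
          ≈⟨ det-scaleCols (suc n) (λ j → prefixFactor (suc p) s (toℕ j)) (homogeneousPowers p) ⟩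
        ∏ {suc n} (λ j → prefixFactor (suc p) s (toℕ j)) * det R (suc n) (homogeneousPowers p)
          ≈⟨ *-congʳ (∏-prefixFactor (suc p) s (ℕ.m≤n⇒m≤1+n p<n)) ⟩
        s ^ suc p * det R (suc n) (homogeneousPowers p) ∎

      det-homogeneousPowers : ∀ p → p ℕ.≤ n →
        det R (suc n) (homogeneousPowers p) ≈ s ^ triangle p * det R (suc n) (fromRows (λ i c → y i ^ c))
      det-homogeneousPowers zero _ = begin
        det R (suc n) (homogeneousPowers 0)          ≈⟨ det-cong (suc n) (λ i j → reflexive (≡.cong (λ e → x i ^ e * y i ^ toℕ j) (ℕ.0∸n≡0 (toℕ j)))) ⟩
        det R (suc n) (λ i j → 1# * y i ^ toℕ j)     ≈⟨ det-cong (suc n) (λ i j → *-identityˡ (y i ^ toℕ j)) ⟩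
        det R (suc n) (fromRows (λ i c → y i ^ c))   ≈⟨ *-identityˡ _ ⟨
        1# * det R (suc n) (fromRows (λ i c → y i ^ c)) ∎
      det-homogeneousPowers (suc p) p<n = begin
        det R (suc n) (homogeneousPowers (suc p))    ≈⟨ det-homogeneousPowers-suc p p<n ⟩
        s ^ suc p * det R (suc n) (homogeneousPowers p) ≈⟨ *-congˡ (det-homogeneousPowers p (ℕ.<⇒≤ p<n)) ⟩
        s ^ suc p * (s ^ triangle p * D)             ≈⟨ solve 3 (λ a b D → a :* (b :* D) := (b :* a) :* D) refl _ _ D ⟩
        (s ^ triangle p * s ^ suc p) * D             ≈⟨ *-congʳ (^-homo-* s (triangle p) (suc p)) ⟨
        s ^ triangle (suc p) * D                     ∎
        where D = det R (suc n) (fromRows (λ i c → y i ^ c))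

  consecutiveVandermonde : Carrier → (n : ℕ) → Matrix n
  consecutiveVandermonde b n = fromRows (λ i c → (b + ι R (toℕ i)) ^ c)

  ∏-ι-suc : ∀ n → ∏ (λ (i : Fin n) → ι R (suc (toℕ i))) ≈ ι R (n !)
  ∏-ι-suc zero    = sym (+-identityʳ 1#)
  ∏-ι-suc (suc n) = begin
    ∏ {suc n} (λ i → ι R (suc (toℕ i)))            ≈⟨ ∏-init-last {n} (λ i → ι R (suc (toℕ i))) ⟩
    ∏ {n} (λ i → ι R (suc (toℕ (inject₁ i)))) * ι R (suc (toℕ (fromℕ n)))
      ≈⟨ *-cong (∏-cong {n} (λ i → reflexive (≡.cong (ι R ∘ suc) (Fin.toℕ-inject₁ i))))
                (reflexive (≡.cong (ι R ∘ suc) (Fin.toℕ-fromℕ n))) ⟩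
    ∏ {n} (λ i → ι R (suc (toℕ i))) * ι R (suc n)    ≈⟨ *-congʳ (∏-ι-suc n) ⟩
    ι R (n !) * ι R (suc n)                          ≈⟨ ×1-homo-* (n !) (suc n) ⟨
    ι R (n ! ℕ.* suc n)                              ≡⟨ ≡.cong (ι R) (ℕ.*-comm (n !) (suc n)) ⟩
    ι R (suc n !)                                    ∎

  det-consecutiveVandermonde : ∀ k b → det R (suc k) (consecutiveVandermonde b (suc k)) ≈ ι R (superfactorial k)
  det-consecutiveVandermonde zero    b = +-congʳ (trans (*-identityʳ _) (*-identityʳ 1#))
  det-consecutiveVandermonde (suc k) b = begin
    det R n V                                                  ≈⟨ det-sweepLeft f (- b) ⟨
    det R n W                                                  ≈⟨ det-expandCorner (suc k) W firstRow≈0 ⟩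
    1# * det R (suc k) (λ i j → W (suc i) (suc j))             ≈⟨ *-identityˡ _ ⟩
    det R (suc k) (λ i j → W (suc i) (suc j))                  ≈⟨ det-cong (suc k) lowerBlock ⟩
    det R (suc k) (λ i j → ι R (suc (toℕ i)) * V′ i j)          ≈⟨ det-scaleRows (suc k) (λ i → ι R (suc (toℕ i))) V′ ⟩
    ∏ {suc k} (λ i → ι R (suc (toℕ i))) * det R (suc k) V′     ≈⟨ *-cong (∏-ι-suc (suc k)) (det-consecutiveVandermonde k (b + 1#)) ⟩
    ι R (suc k !) * ι R (superfactorial k)                     ≈⟨ *-comm _ _ ⟩
    ι R (superfactorial k) * ι R (suc k !)                     ≈⟨ ×1-homo-* (superfactorial k) (suc k !) ⟨
    ι R (superfactorial (suc k))                               ∎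
    where
    n = suc (suc k)
    V = consecutiveVandermonde b n
    V′ = consecutiveVandermonde (b + 1#) (suc k)
    f : Fin n → ℕ → Carrier
    f i c = (b + ι R (toℕ i)) ^ c
    W : Matrix n
    W = fromRows (λ i → sweepLeft (- b) 0 (f i))
    factor : ∀ z c → z * z ^ c + (- b) * z ^ c ≈ (z - b) * z ^ c
    factor z c = sym (distribʳ (z ^ c) z (- b))
    firstRow≈0 : ∀ j → W zero (suc j) ≈ 0#
    firstRow≈0 j = trans (factor (b + 0#) (toℕ j)) (trans (*-congʳ (xyx⁻¹≈y b 0#)) (zeroˡ _))
    lowerBlock : ∀ i j → W (suc i) (suc j) ≈ ι R (suc (toℕ i)) * V′ i j
    lowerBlock i j = trans (factor (b + ι R (suc (toℕ i))) (toℕ j))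
                           (*-cong (xyx⁻¹≈y b _) (^-congˡ (toℕ j) (sym (+-assoc b 1# _))))

proposition1 : ∀ {c ℓ : Level} (R : CommutativeRing c ℓ) (k : ℕ) (a b : CommutativeRing.Carrier R) →
    CommutativeRing._≈_ R (det R (suc k) (A R k a b))
      (CommutativeRing._*_ R (pow R (CommutativeRing._+_ R a b) (triangle k)) (ι R (superfactorial k)))
proposition1 R k a b = begin
  det R (suc k) (A R k a b)
    ≈⟨ det-homogeneousPowers R x y (a + b) (λ i → x-u+[y+u]≈x+y R a b (ι R (toℕ i))) k ℕ.≤-refl ⟩
  pow R (a + b) (triangle k) * det R (suc k) (consecutiveVandermonde R b (suc k))
    ≈⟨ *-congˡ (det-consecutiveVandermonde R k b) ⟩
  pow R (a + b) (triangle k) * ι R (superfactorial k) ∎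
  where
  open CommutativeRing R
  open import Relation.Binary.Reasoning.Setoid setoid
  x y : Fin (suc k) → Carrier
  x i = a - ι R (toℕ i)
  y i = b + ι R (toℕ i)
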